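{- Let $(a_n)_{n\ge0}$ be a sequence, let $\mathbb{B}=(b_{n,k})_{n,k\ge0}$ be the matrix $\mathbb{B}=L\cdot(1+x,x)^t$ where $L=\left(\frac{1-x}{1+x^2},\frac{x}{1+x^2}\right)^{ -1}$, and let $b_n=\sum_{k=0}^{n+1}b_{n,k}a_k$. Then $$b_n=\sum_{k=0}^n \binom{n+1}{\frac{n-k}{2}}\frac{k+1}{n+1}\frac{1+(-1)^{n-k}}{2}\Big(\sum_{j=0}^k a_j+\sum_{j=1}^{k+1}a_j\Big),$$ or equivalently $$b_n=\sum_{k=0}^n \binom{n+1}{\frac{n-k}{2}}\frac{k+1}{n+1}\frac{1+(-1)^{n-k}}{2}\Big(2\sum_{j=0}^k a_j+a_{k+1}-a_0\Big),$$ where terms with $n-k$ odd are zero.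
   Context: A Riordan array $(g,f)$, where $g(x)=1+g_1x+\cdots$ and $f(x)=x+f_2x^2+\cdots$ are formal power series, is the infinite lower-triangular matrix (rows and columns indexed from $0$) whose $k$-th column has ordinary generating function $g(x)f(x)^k$; Riordan arrays form a group under matrix multiplication with $(g,f)(h,l)=(g\,(h\circ f),l\circ f)$. $M^t$ denotes the transpose of $M$; $(1+x,x)^t$ is the upper-triangular matrix with $1$ on the main diagonal and first superdiagonal and $0$ elsewhere. Row $n$ of $\mathbb{B}$ has nonzero entries only in columns $0,\dots,n+1$. -}

module Defs where

open import Data.Nat as ℕ using (ℕ; zero; suc; _∸_; _≡ᵇ_)
open import Data.Nat.Combinatorics using (_C_)
open import Data.Nat.DivMod using (_/_)
open import Data.Integer using (+_)
open import Data.Bool using (if_then_else_)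
open import Data.List using (List; []; _∷_; _++_)
open import Data.Rational using (ℚ; 0ℚ; 1ℚ; _+_; _*_; -_) renaming (_/_ to _÷_)

sumTo : ℕ → (ℕ → ℚ) → ℚ
sumTo zero    f = f 0
sumTo (suc n) f = sumTo n f + f (suc n)

sumBelow : ℕ → (ℕ → ℚ) → ℚ
sumBelow zero    f = 0ℚ
sumBelow (suc n) f = sumBelow n f + f n

sumFromTo : ℕ → ℕ → (ℕ → ℚ) → ℚ
sumFromTo m n f = sumBelow (suc n ∸ m) (λ i → f (m ℕ.+ i))

negOnePow : ℕ → ℚ
negOnePow zero    = 1ℚ
negOnePow (suc m) = - negOnePow m

fromℕ : ℕ → ℚ
fromℕ n = + n ÷ 1

δ : ℕ → ℕ → ℚ
δ m n = if m ≡ᵇ n then 1ℚ else 0ℚ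

-- Course-of-values recursion helper (values at indices < n available)

at : {A : Set} → A → List A → ℕ → A
at d []       _       = d
at d (x ∷ xs) zero    = x
at d (x ∷ xs) (suc i) = at d xs i

memo : {A : Set} → A → (ℕ → (ℕ → A) → A) → ℕ → List A
memo d s zero    = []
memo d s (suc n) = memo d s n ++ (s n (at d (memo d s n)) ∷ [])

cvRec : {A : Set} → A → (ℕ → (ℕ → A) → A) → ℕ → A
cvRec d s n = s n (at d (memo d s n))

-- Formal power series over ℚ (coefficient sequences)

Series : Set
Series = ℕ → ℚ

oneS : Series
oneS = δ 0

xS : Series
xS = δ 1

_⊕_ : Series → Series → Series
(f ⊕ g) n = f n + g n

⊖_ : Series → Series
(⊖ f) n = - f n

_⊛_ : Series → Series → Series
(f ⊛ g) n = sumTo n (λ i → f i * g (n ∸ i))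

powS : Series → ℕ → Series
powS f zero    = oneS
powS f (suc k) = f ⊛ powS f k

-- multiplicative inverse of a series with constant term 1:
-- h 0 = 1,  h n = - Σ_{i=1}^{n} g i h (n - i)
invS : Series → Series
invS g = cvRec 0ℚ step
  where
  step : ℕ → (ℕ → ℚ) → ℚ
  step zero    prev = 1ℚ
  step (suc n) prev = - sumFromTo 1 (suc n) (λ i → g i * prev (suc n ∸ i))

Matrix : Set
Matrix = ℕ → ℕ → ℚ

transpose : Matrix → Matrix
transpose M i j = M j i

riordan : Series → Series → Matrix
riordan g f n k = (g ⊛ powS f k) n

-- Inverse of a lower-triangular matrix with unit diagonal (as every
-- Riordan array is), computed by solving R · L = I row by row:
-- L n k = δ n k - Σ_{j<n} R n j · L j k.
lowerInv : Matrix → Matrix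
lowerInv R = cvRec (λ _ → 0ℚ) step
  where
  step : ℕ → (ℕ → ℕ → ℚ) → ℕ → ℚ
  step n prev k = δ n k + - sumBelow n (λ j → R n j * prev j k)

gR : Series
gR = (oneS ⊕ (⊖ xS)) ⊛ invS (oneS ⊕ powS xS 2)

fR : Series
fR = xS ⊛ invS (oneS ⊕ powS xS 2)

Lmat : Matrix
Lmat = lowerInv (riordan gR fR)

Umat : Matrix
Umat = transpose (riordan (oneS ⊕ xS) xS)

-- 𝔹 = L · (1+x,x)^t ; L is lower triangular so only j ≤ n contribute
Bmat : Matrix
Bmat n k = sumTo n (λ j → Lmat n j * Umat j k)

bSeq : (ℕ → ℚ) → ℕ → ℚ
bSeq a n = sumTo (suc n) (λ k → Bmat n k * a k)

-- binom(n+1, (n-k)/2) · (k+1)/(n+1) · (1 + (-1)^(n-k))/2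
-- (for n-k odd the factor (1+(-1)^(n-k))/2 is 0, so the floor in (n-k)/2 is irrelevant)
coef : ℕ → ℕ → ℚ
coef n k = fromℕ ((suc n) C ((n ∸ k) / 2))
         * ((+ suc k) ÷ suc n)
         * ((1ℚ + negOnePow (n ∸ k)) * (+ 1 ÷ 2))

module Submission where

-- Write R = ((1-x)/(1+x²), x/(1+x²)).  Clearing the denominator
-- 1 + x² in the columns of R gives the three-term recurrence
--   R(j+2, k+1) = R(j+1, k) - R(j, k+1),
-- and from it one checks that L = R⁻¹ is the matrix ballotTail whose entry
-- (n, k) counts the nonnegative ±1 walks of length n ending at height ≥ k.
-- Since (1+x, x)ᵗ only adds neighbouring columns, b_n = Σ_k L(n,k)(a_k + a_{k+1}),
-- and Abel summation turns this into Σ_k ballot(n,k)·Σ_{j≤k}(a_j + a_{j+1}),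
-- where ballot(n,k) = L(n,k) - L(n,k+1) counts the walks ending exactly at k.
-- The ballot theorem identifies ballot(n,k) with the coefficient
-- C(n+1, (n-k)/2)·(k+1)/(n+1)·[n-k even] of the statement.

open import Data.Nat using (ℕ; zero; suc; _≤_; _<_; z≤n; s≤s; _∸_)
import Data.Nat as ℕ
import Data.Nat.Properties as ℕₚ
open import Relation.Binary.PropositionalEquality
import Relation.Binary.Reasoning.Setoid as SetoidReasoning
open import Defs

module Ballot where

  open import Data.Nat using (_+_; _*_)
  open import Data.Nat.Combinatorics
    using (_C_; nCk+nC[k+1]≡[n+1]C[k+1]; k>n⇒nCk≡0; nCk≡nC[n∸k])
  open import Data.Nat.Solver using (module +-*-Solver)
  open +-*-Solver using (solve; _:+_; _:*_; _:=_; con)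
  open ≡-Reasoning

  -- ballot n k is the number of ±1 walks of length n from height 0 that
  -- never go below 0 and end at height k.
  ballot : ℕ → ℕ → ℕ
  ballot zero    zero    = 1
  ballot zero    (suc k) = 0
  ballot (suc n) zero    = ballot n 1
  ballot (suc n) (suc k) = ballot n k + ballot n (suc (suc k))

  ballot-above : ∀ n k → n < k → ballot n k ≡ 0
  ballot-above zero    (suc k) _       = refl
  ballot-above (suc n) (suc k) (s≤s p) =
    cong₂ _+_ (ballot-above n k p)
              (ballot-above n (suc (suc k)) (ℕₚ.m<n⇒m<1+n (ℕₚ.m<n⇒m<1+n p)))

  C-prev : ℕ → ℕ → ℕ
  C-prev n zero    = 0
  C-prev n (suc j) = n C j

  pascal : ∀ n j → suc n C j ≡ n C j + C-prev n j
  pascal n zero    = refl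
  pascal n (suc j) = trans (sym (nCk+nC[k+1]≡[n+1]C[k+1] n j)) (ℕₚ.+-comm (n C j) (n C suc j))

  absorption      : ∀ n j → suc j * (suc n C suc j) ≡ suc n * (n C j)
  absorption-prev : ∀ n j → j * (suc n C j) ≡ suc n * C-prev n j

  absorption-prev n zero    = sym (ℕₚ.*-zeroʳ n)
  absorption-prev n (suc j) = absorption n j

  absorption zero zero    = refl
  absorption zero (suc j) =
    trans (cong (suc (suc j) *_) (k>n⇒nCk≡0 {1} {suc (suc j)} (s≤s (s≤s z≤n))))
          (ℕₚ.*-zeroʳ (suc (suc j)))
  absorption (suc n) j = begin
      suc j * (suc (suc n) C suc j)
    ≡⟨ cong (suc j *_) (sym (nCk+nC[k+1]≡[n+1]C[k+1] (suc n) j)) ⟩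
      suc j * (suc n C j + suc n C suc j)
    ≡⟨ ℕₚ.*-distribˡ-+ (suc j) (suc n C j) (suc n C suc j) ⟩
      (suc n C j + j * (suc n C j)) + suc j * (suc n C suc j)
    ≡⟨ cong₂ (λ u v → (suc n C j + u) + v) (absorption-prev n j) (absorption n j) ⟩
      (suc n C j + suc n * C-prev n j) + suc n * (n C j)
    ≡⟨ solve 4 (λ c p m x → (c :+ m :* p) :+ m :* x := c :+ m :* (x :+ p))
               refl (suc n C j) (C-prev n j) (suc n) (n C j) ⟩
      suc n C j + suc n * (n C j + C-prev n j)
    ≡⟨ cong (λ z → suc n C j + suc n * z) (sym (pascal n j)) ⟩
      suc (suc n) * (suc n C j)
    ∎

  weighted-pascal : ∀ n j → suc j * (n C suc j) + j * (n C j) ≡ n * (n C j)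
  weighted-pascal zero zero       = refl
  weighted-pascal zero (suc j)    = cong₂ _+_ (ℕₚ.*-zeroʳ (suc (suc j))) (ℕₚ.*-zeroʳ (suc j))
  weighted-pascal (suc n) j =
    trans (cong₂ _+_ (absorption n j) (absorption-prev n j))
          (trans (sym (ℕₚ.*-distribˡ-+ (suc n) (n C j) (C-prev n j)))
                 (cong (suc n *_) (sym (pascal n j))))

  binomial-ratio : ∀ m k → m * ((k + (m + m)) C m) ≡ suc (k + m) * C-prev (k + (m + m)) m
  binomial-ratio zero    k = sym (ℕₚ.*-zeroʳ (suc (k + 0)))
  binomial-ratio (suc j) k =
    ℕₚ.+-cancelʳ-≡ (j * B) (suc j * (n C suc j)) (suc (k + suc j) * B)
      (trans (weighted-pascal n j)
             (trans (cong (_* B) n≡) (ℕₚ.*-distribʳ-+ B (suc (k + suc j)) j)))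
    where
    n = k + (suc j + suc j)
    B = n C j
    n≡ : n ≡ suc (k + suc j) + j
    n≡ = trans (cong (k +_) (ℕₚ.+-suc (suc j) j))
               (trans (ℕₚ.+-suc k (suc (j + j))) (cong suc (sym (ℕₚ.+-assoc k (suc j) j))))

  central-symmetry : ∀ m → suc (m + m) C suc m ≡ suc (m + m) C m
  central-symmetry m =
    trans (nCk≡nC[n∸k] (s≤s (ℕₚ.m≤m+n m m))) (cong (suc (m + m) C_) (ℕₚ.m+n∸m≡n m m))

  shift-height : ∀ k m → suc (suc k) + (m + m) ≡ k + (suc m + suc m)
  shift-height k m =
    sym (trans (ℕₚ.+-suc k (m + suc m))
               (cong suc (trans (cong (k +_) (ℕₚ.+-suc m m)) (ℕₚ.+-suc k (m + m)))))

  ballot-even : ∀ m k → ballot (k + (m + m)) k + C-prev (k + (m + m)) m ≡ (k + (m + m)) C m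
  ballot-even zero zero    = refl
  ballot-even zero (suc k) =
    trans (cong (λ z → (ballot (k + 0) k + z) + 0) (ballot-above (k + 0) (suc (suc k)) k+0<k+2))
          (cong (_+ 0) (ballot-even zero k))
    where k+0<k+2 = s≤s (ℕₚ.≤-trans (ℕₚ.≤-reflexive (ℕₚ.+-identityʳ k)) (ℕₚ.n≤1+n k))
  ballot-even (suc m) zero rewrite ℕₚ.+-suc m m = begin
      ballot n 1 + suc n C m
    ≡⟨ cong (ballot n 1 +_) (pascal n m) ⟩
      ballot n 1 + (n C m + C-prev n m)
    ≡⟨ solve 3 (λ b c d → b :+ (c :+ d) := (b :+ d) :+ c) refl (ballot n 1) (n C m) (C-prev n m) ⟩
      (ballot n 1 + C-prev n m) + n C m
    ≡⟨ cong (_+ n C m) (ballot-even m 1) ⟩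
      n C m + n C m
    ≡⟨ cong (n C m +_) (sym (central-symmetry m)) ⟩
      n C m + n C suc m
    ≡⟨ nCk+nC[k+1]≡[n+1]C[k+1] n m ⟩
      suc n C suc m
    ∎
    where n = suc (m + m)
  ballot-even (suc m) (suc k) = begin
      (ballot n k + ballot n (suc (suc k))) + suc n C m
    ≡⟨ cong (ballot n k + ballot n (suc (suc k)) +_) (pascal n m) ⟩
      (ballot n k + ballot n (suc (suc k))) + (n C m + C-prev n m)
    ≡⟨ solve 4 (λ x y b d → (x :+ y) :+ (b :+ d) := (x :+ b) :+ (y :+ d))
               refl (ballot n k) (ballot n (suc (suc k))) (n C m) (C-prev n m) ⟩
      (ballot n k + n C m) + (ballot n (suc (suc k)) + C-prev n m)
    ≡⟨ cong₂ _+_ (ballot-even (suc m) k) lower ⟩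
      n C suc m + n C m
    ≡⟨ ℕₚ.+-comm (n C suc m) (n C m) ⟩
      n C m + n C suc m
    ≡⟨ nCk+nC[k+1]≡[n+1]C[k+1] n m ⟩
      suc n C suc m
    ∎
    where
    n = k + (suc m + suc m)
    lower : ballot n (suc (suc k)) + C-prev n m ≡ n C m
    lower = subst (λ z → ballot z (suc (suc k)) + C-prev z m ≡ z C m)
                  (shift-height k m) (ballot-even m (suc (suc k)))

  ballot-odd : ∀ m k → ballot (suc (k + (m + m))) k ≡ 0
  ballot-odd zero    zero    = refl
  ballot-odd (suc m) zero    rewrite ℕₚ.+-suc m m = ballot-odd m 1
  ballot-odd zero    (suc k) =
    cong₂ _+_ (ballot-odd zero k)
              (ballot-above (suc (k + 0)) (suc (suc k)) (s≤s (s≤s (ℕₚ.≤-reflexive (ℕₚ.+-identityʳ k)))))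
  ballot-odd (suc m) (suc k) =
    cong₂ _+_ (ballot-odd (suc m) k)
              (subst (λ z → ballot (suc z) (suc (suc k)) ≡ 0) (shift-height k m) (ballot-odd m (suc (suc k))))

  -- The closed form  ballot n k = C(n+1, m)·(k+1)/(n+1)  for n = k + 2m,
  -- written without division.
  ballot-closed : ∀ m k → ballot (k + (m + m)) k * suc (k + (m + m)) ≡ (suc (k + (m + m)) C m) * suc k
  ballot-closed m k =
    trans (ℕₚ.+-cancelʳ-≡ (B * suc n) (x * suc n) ((A + B) * suc k) sum-form)
          (cong (_* suc k) (sym (pascal n m)))
    where
    n = k + (m + m)
    x = ballot n k
    A = n C m
    B = C-prev n m
    sum-form : x * suc n + B * suc n ≡ (A + B) * suc k + B * suc n
    sum-form = begin
        x * suc n + B * suc n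
      ≡⟨ sym (ℕₚ.*-distribʳ-+ (suc n) x B) ⟩
        (x + B) * suc n
      ≡⟨ cong (_* suc n) (ballot-even m k) ⟩
        A * suc (k + (m + m))
      ≡⟨ solve 3 (λ a k m → a :* (con 1 :+ (k :+ (m :+ m))) := a :* (con 1 :+ k) :+ (m :* a :+ m :* a))
                 refl A k m ⟩
        A * suc k + (m * A + m * A)
      ≡⟨ cong (λ z → A * suc k + (z + z)) (binomial-ratio m k) ⟩
        A * suc k + (suc (k + m) * B + suc (k + m) * B)
      ≡⟨ solve 4 (λ a b k m → a :* (con 1 :+ k) :+ ((con 1 :+ (k :+ m)) :* b :+ (con 1 :+ (k :+ m)) :* b)
                            := (a :+ b) :* (con 1 :+ k) :+ b :* (con 1 :+ (k :+ (m :+ m))))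
                 refl A B k m ⟩
        (A + B) * suc k + B * suc n
      ∎

open Ballot using (ballot; ballot-odd; ballot-closed)

open import Data.Product using (_×_; _,_; proj₁; proj₂; Σ-syntax)
open import Data.Sum using (_⊎_; inj₁; inj₂)
open import Data.Nat.Induction using (<-rec)
open import Function using (_∘_)
open import Relation.Nullary using (yes; no; contradiction)
open import Data.List using ([]; _∷_; _++_; length)
open import Data.List.Properties using (length-++)
open import Data.Rational using (ℚ; 0ℚ; 1ℚ; _+_; _*_; -_; _-_; toℚᵘ) renaming (_/_ to _÷_)
open import Data.Rational.Properties
  using ( *-comm; *-assoc; *-identityˡ; *-identityʳ; *-zeroˡ; *-zeroʳ; *-distribˡ-+; *-distribʳ-+
        ; +-identityˡ; +-identityʳ; +-assoc; +-comm
        ; toℚᵘ-injective; toℚᵘ-fromℚᵘ; toℚᵘ-homo-+; toℚᵘ-homo-* )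
open import Data.Rational.Solver using (module +-*-Solver)
open +-*-Solver using (solve; _:+_; _:*_; :-_; _:=_; con)
import Data.Rational.Unnormalised as ℚᵘ
import Data.Rational.Unnormalised.Properties as ℚᵘₚ
import Data.Integer as ℤ
import Data.Integer.Properties as ℤₚ
import Data.Nat.DivMod as ℕ
open import Data.Nat.Combinatorics using (_C_)

fromℕ-toℚᵘ : ∀ n → toℚᵘ (fromℕ n) ℚᵘ.≃ ℚᵘ.mkℚᵘ (ℤ.+ n) 0
fromℕ-toℚᵘ n = toℚᵘ-fromℚᵘ (ℚᵘ.mkℚᵘ (ℤ.+ n) 0)

fromℕ-+ : ∀ m n → fromℕ (m ℕ.+ n) ≡ fromℕ m + fromℕ n
fromℕ-+ m n =
  toℚᵘ-injective
    (ℚᵘₚ.≃-trans (fromℕ-toℚᵘ (m ℕ.+ n))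
      (ℚᵘₚ.≃-trans sum-of-integers
        (ℚᵘₚ.≃-sym (ℚᵘₚ.≃-trans (toℚᵘ-homo-+ (fromℕ m) (fromℕ n))
                                (ℚᵘₚ.+-cong (fromℕ-toℚᵘ m) (fromℕ-toℚᵘ n))))))
  where
  sum-of-integers : ℚᵘ.mkℚᵘ (ℤ.+ (m ℕ.+ n)) 0 ℚᵘ.≃ (ℚᵘ.mkℚᵘ (ℤ.+ m) 0 ℚᵘ.+ ℚᵘ.mkℚᵘ (ℤ.+ n) 0)
  sum-of-integers = ℚᵘ.*≡* (trans (ℤₚ.*-identityʳ (ℤ.+ (m ℕ.+ n)))
    (sym (trans (ℤₚ.*-identityʳ _) (cong₂ ℤ._+_ (ℤₚ.*-identityʳ (ℤ.+ m)) (ℤₚ.*-identityʳ (ℤ.+ n))))))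

fromℕ-*-÷ : ∀ X Y a b → Y ℕ.* suc b ≡ X ℕ.* a → fromℕ X * (ℤ.+ a ÷ suc b) ≡ fromℕ Y
fromℕ-*-÷ X Y a b cross =
  toℚᵘ-injective
    (ℚᵘₚ.≃-trans (toℚᵘ-homo-* (fromℕ X) (ℤ.+ a ÷ suc b))
      (ℚᵘₚ.≃-trans (ℚᵘₚ.*-cong (fromℕ-toℚᵘ X) (toℚᵘ-fromℚᵘ (ℚᵘ.mkℚᵘ (ℤ.+ a) b)))
        (ℚᵘₚ.≃-trans cross-multiplied (ℚᵘₚ.≃-sym (fromℕ-toℚᵘ Y)))))
  where
  cross-multiplied : (ℚᵘ.mkℚᵘ (ℤ.+ X) 0 ℚᵘ.* ℚᵘ.mkℚᵘ (ℤ.+ a) b) ℚᵘ.≃ ℚᵘ.mkℚᵘ (ℤ.+ Y) 0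
  cross-multiplied = ℚᵘ.*≡* (trans (ℤₚ.*-identityʳ _) (trans (sym (ℤₚ.pos-* X a))
    (trans (cong ℤ.+_ (sym cross)) (trans (ℤₚ.pos-* Y (suc b)) (cong (λ d → ℤ.+ Y ℤ.* ℤ.+ d) (sym (ℕₚ.*-identityˡ (suc b))))))))

parity : ∀ d → (Σ[ m ∈ ℕ ] d ≡ m ℕ.+ m) ⊎ (Σ[ m ∈ ℕ ] d ≡ suc (m ℕ.+ m))
parity zero = inj₁ (0 , refl)
parity (suc d) with parity d
... | inj₁ (m , d≡) = inj₂ (m , cong suc d≡)
... | inj₂ (m , d≡) = inj₁ (suc m , cong suc (trans d≡ (sym (ℕₚ.+-suc m m))))

half-double : ∀ m → (m ℕ.+ m) ℕ./ 2 ≡ m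
half-double m =
  trans (cong (ℕ._/ 2) (trans (cong (m ℕ.+_) (sym (ℕₚ.+-identityʳ m))) (ℕₚ.*-comm 2 m)))
        (ℕ.m*n/n≡m m 2)

negOnePow-even : ∀ m → negOnePow (m ℕ.+ m) ≡ 1ℚ
negOnePow-even zero = refl
negOnePow-even (suc m) rewrite ℕₚ.+-suc m m = cong (λ z → - - z) (negOnePow-even m)

-- coef n k with n ∸ k abstracted, so that its parity can be substituted.
coef-at : ∀ n k d → d ≡ n ∸ k →
  coef n k ≡ fromℕ (suc n C (d ℕ./ 2)) * ((ℤ.+ suc k) ÷ suc n) * ((1ℚ + negOnePow d) * (ℤ.+ 1 ÷ 2))
coef-at n k d refl = refl

coef-ballot-even : ∀ m k → coef (k ℕ.+ (m ℕ.+ m)) k ≡ fromℕ (ballot (k ℕ.+ (m ℕ.+ m)) k)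
coef-ballot-even m k = begin
    coef N k
  ≡⟨ coef-at N k (m ℕ.+ m) (sym (ℕₚ.m+n∸m≡n k (m ℕ.+ m))) ⟩
    fromℕ (suc N C ((m ℕ.+ m) ℕ./ 2)) * ((ℤ.+ suc k) ÷ suc N) * ((1ℚ + negOnePow (m ℕ.+ m)) * (ℤ.+ 1 ÷ 2))
  ≡⟨ cong₂ (λ j s → fromℕ (suc N C j) * ((ℤ.+ suc k) ÷ suc N) * ((1ℚ + s) * (ℤ.+ 1 ÷ 2)))
           (half-double m) (negOnePow-even m) ⟩
    fromℕ (suc N C m) * ((ℤ.+ suc k) ÷ suc N) * 1ℚ
  ≡⟨ *-identityʳ _ ⟩
    fromℕ (suc N C m) * ((ℤ.+ suc k) ÷ suc N)
  ≡⟨ fromℕ-*-÷ (suc N C m) (ballot N k) (suc k) N (ballot-closed m k) ⟩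
    fromℕ (ballot N k)
  ∎
  where
  open ≡-Reasoning
  N = k ℕ.+ (m ℕ.+ m)

coef-ballot-odd : ∀ m k → coef (suc (k ℕ.+ (m ℕ.+ m))) k ≡ fromℕ (ballot (suc (k ℕ.+ (m ℕ.+ m))) k)
coef-ballot-odd m k = begin
    coef N k
  ≡⟨ coef-at N k (suc (m ℕ.+ m))
             (sym (trans (cong (_∸ k) (sym (ℕₚ.+-suc k (m ℕ.+ m)))) (ℕₚ.m+n∸m≡n k (suc (m ℕ.+ m))))) ⟩
    c * ((1ℚ + - negOnePow (m ℕ.+ m)) * (ℤ.+ 1 ÷ 2))
  ≡⟨ cong (λ s → c * ((1ℚ + - s) * (ℤ.+ 1 ÷ 2))) (negOnePow-even m) ⟩
    c * 0ℚ
  ≡⟨ *-zeroʳ c ⟩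
    0ℚ
  ≡⟨ cong fromℕ (ballot-odd m k) ⟨
    fromℕ (ballot N k)
  ∎
  where
  open ≡-Reasoning
  N = suc (k ℕ.+ (m ℕ.+ m))
  c = fromℕ (suc N C (suc (m ℕ.+ m) ℕ./ 2)) * ((ℤ.+ suc k) ÷ suc N)

coef-ballot : ∀ n k → k ≤ n → coef n k ≡ fromℕ (ballot n k)
coef-ballot n k k≤n with parity (n ∸ k)
... | inj₁ (m , n∸k≡) = subst (λ z → coef z k ≡ fromℕ (ballot z k)) n≡ (coef-ballot-even m k)
  where
  n≡ : k ℕ.+ (m ℕ.+ m) ≡ n
  n≡ = trans (cong (k ℕ.+_) (sym n∸k≡)) (ℕₚ.m+[n∸m]≡n k≤n)
... | inj₂ (m , n∸k≡) = subst (λ z → coef z k ≡ fromℕ (ballot z k)) n≡ (coef-ballot-odd m k)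
  where
  n≡ : suc (k ℕ.+ (m ℕ.+ m)) ≡ n
  n≡ = trans (sym (ℕₚ.+-suc k (m ℕ.+ m))) (trans (cong (k ℕ.+_) (sym n∸k≡)) (ℕₚ.m+[n∸m]≡n k≤n))

sumTo-cong : ∀ n {f g : ℕ → ℚ} → (∀ i → i ≤ n → f i ≡ g i) → sumTo n f ≡ sumTo n g
sumTo-cong zero    f≡g = f≡g 0 z≤n
sumTo-cong (suc n) f≡g =
  cong₂ _+_ (sumTo-cong n (λ i i≤n → f≡g i (ℕₚ.m≤n⇒m≤1+n i≤n))) (f≡g (suc n) ℕₚ.≤-refl)

sumBelow-cong : ∀ n {f g : ℕ → ℚ} → (∀ i → i < n → f i ≡ g i) → sumBelow n f ≡ sumBelow n g
sumBelow-cong zero    f≡g = refl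
sumBelow-cong (suc n) f≡g =
  cong₂ _+_ (sumBelow-cong n (λ i i<n → f≡g i (ℕₚ.m<n⇒m<1+n i<n))) (f≡g n ℕₚ.≤-refl)

sumBelow-suc : ∀ n (f : ℕ → ℚ) → sumBelow (suc n) f ≡ sumTo n f
sumBelow-suc zero    f = +-identityˡ (f 0)
sumBelow-suc (suc n) f = cong (_+ f (suc n)) (sumBelow-suc n f)

sumTo-last : ∀ n (f : ℕ → ℚ) → sumTo n f ≡ sumBelow n f + f n
sumTo-last n f = sym (sumBelow-suc n f)

sumTo-+ : ∀ n (f g : ℕ → ℚ) → sumTo n (λ i → f i + g i) ≡ sumTo n f + sumTo n g
sumTo-+ zero    f g = refl
sumTo-+ (suc n) f g =
  trans (cong (_+ (f (suc n) + g (suc n))) (sumTo-+ n f g))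
        (solve 4 (λ a b c d → (a :+ b) :+ (c :+ d) := (a :+ c) :+ (b :+ d)) refl
               (sumTo n f) (sumTo n g) (f (suc n)) (g (suc n)))

sumTo-*ˡ : ∀ n c (f : ℕ → ℚ) → sumTo n (λ i → c * f i) ≡ c * sumTo n f
sumTo-*ˡ zero    c f = refl
sumTo-*ˡ (suc n) c f =
  trans (cong (_+ (c * f (suc n))) (sumTo-*ˡ n c f)) (sym (*-distribˡ-+ c (sumTo n f) (f (suc n))))

sumTo-*ʳ : ∀ n c (f : ℕ → ℚ) → sumTo n (λ i → f i * c) ≡ sumTo n f * c
sumTo-*ʳ zero    c f = refl
sumTo-*ʳ (suc n) c f =
  trans (cong (_+ (f (suc n) * c)) (sumTo-*ʳ n c f)) (sym (*-distribʳ-+ c (sumTo n f) (f (suc n))))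

sumTo-neg : ∀ n (f : ℕ → ℚ) → sumTo n (λ i → - f i) ≡ - sumTo n f
sumTo-neg zero    f = refl
sumTo-neg (suc n) f =
  trans (cong (_+ (- f (suc n))) (sumTo-neg n f))
        (solve 2 (λ a b → (:- a) :+ (:- b) := :- (a :+ b)) refl (sumTo n f) (f (suc n)))

sumTo-zero : ∀ n (f : ℕ → ℚ) → (∀ i → f i ≡ 0ℚ) → sumTo n f ≡ 0ℚ
sumTo-zero zero    f f≡0 = f≡0 0
sumTo-zero (suc n) f f≡0 = cong₂ _+_ (sumTo-zero n f f≡0) (f≡0 (suc n))

sumTo-shift : ∀ n (f : ℕ → ℚ) → sumTo (suc n) f ≡ f 0 + sumTo n (λ i → f (suc i))
sumTo-shift zero    f = refl
sumTo-shift (suc n) f =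
  trans (cong (_+ f (suc (suc n))) (sumTo-shift n f))
        (+-assoc (f 0) (sumTo n (λ i → f (suc i))) (f (suc (suc n))))

sumTo-vanishing-tail : ∀ d n (f : ℕ → ℚ) → (∀ i → n < i → f i ≡ 0ℚ) → sumTo (d ℕ.+ n) f ≡ sumTo n f
sumTo-vanishing-tail zero    n f _   = refl
sumTo-vanishing-tail (suc d) n f f≡0 =
  trans (cong₂ _+_ (sumTo-vanishing-tail d n f f≡0) (f≡0 (suc (d ℕ.+ n)) (s≤s (ℕₚ.m≤n+m n d))))
        (+-identityʳ _)

sumTo-reverse : ∀ n (f : ℕ → ℚ) → sumTo n f ≡ sumTo n (λ i → f (n ∸ i))
sumTo-reverse zero    f = refl
sumTo-reverse (suc n) f = begin
    sumTo (suc n) f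
  ≡⟨ sumTo-shift n f ⟩
    f 0 + sumTo n (λ i → f (suc i))
  ≡⟨ cong (f 0 +_) (sumTo-reverse n (λ i → f (suc i))) ⟩
    f 0 + sumTo n (λ i → f (suc (n ∸ i)))
  ≡⟨ +-comm (f 0) _ ⟩
    sumTo n (λ i → f (suc (n ∸ i))) + f 0
  ≡⟨ cong₂ _+_ (sumTo-cong n (λ i i≤n → cong f (sym (ℕₚ.+-∸-assoc 1 i≤n))))
               (cong f (sym (ℕₚ.n∸n≡0 n))) ⟩
    sumTo (suc n) (λ i → f (suc n ∸ i))
  ∎
  where open ≡-Reasoning

sumTo-triangle : ∀ n (F : ℕ → ℕ → ℚ) →
  sumTo n (λ i → sumTo (n ∸ i) (F i)) ≡ sumTo n (λ m → sumTo m (λ i → F i (m ∸ i)))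
sumTo-triangle zero    F = refl
sumTo-triangle (suc n) F = begin
    sumTo n (λ i → sumTo (suc n ∸ i) (F i)) + sumTo (n ∸ n) (F (suc n))
  ≡⟨ cong₂ _+_ (sumTo-cong n (λ i i≤n → row-grows i i≤n)) (cong (λ z → sumTo z (F (suc n))) (ℕₚ.n∸n≡0 n)) ⟩
    sumTo n (λ i → sumTo (n ∸ i) (F i) + F i (suc n ∸ i)) + F (suc n) 0
  ≡⟨ cong (_+ F (suc n) 0) (sumTo-+ n _ _) ⟩
    (sumTo n (λ i → sumTo (n ∸ i) (F i)) + sumTo n (λ i → F i (suc n ∸ i))) + F (suc n) 0
  ≡⟨ +-assoc (sumTo n (λ i → sumTo (n ∸ i) (F i))) _ _ ⟩
    sumTo n (λ i → sumTo (n ∸ i) (F i)) + (sumTo n (λ i → F i (suc n ∸ i)) + F (suc n) 0)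
  ≡⟨ cong₂ _+_ (sumTo-triangle n F)
               (cong (λ z → sumTo n (λ i → F i (suc n ∸ i)) + F (suc n) z) (sym (ℕₚ.n∸n≡0 n))) ⟩
    sumTo n (λ m → sumTo m (λ i → F i (m ∸ i))) + sumTo (suc n) (λ i → F i (suc n ∸ i))
  ∎
  where
  open ≡-Reasoning
  row-grows : ∀ i → i ≤ n → sumTo (suc n ∸ i) (F i) ≡ sumTo (n ∸ i) (F i) + F i (suc n ∸ i)
  row-grows i i≤n rewrite ℕₚ.+-∸-assoc 1 i≤n = refl

abel-summation : ∀ (t e A : ℕ → ℚ) → (∀ j → e j ≡ t j + e (suc j)) → ∀ m →
  sumTo m (λ k → t k * sumTo k A) + e (suc m) * sumTo m A ≡ sumTo m (λ j → e j * A j)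
abel-summation t e A e≡ zero =
  trans (solve 3 (λ t e a → t :* a :+ e :* a := (t :+ e) :* a) refl (t 0) (e 1) (A 0))
        (cong (_* A 0) (sym (e≡ 0)))
abel-summation t e A e≡ (suc m) =
  trans (solve 5 (λ U S a t₁ e₂ → (U :+ t₁ :* (S :+ a)) :+ e₂ :* (S :+ a)
                                := (U :+ (t₁ :+ e₂) :* S) :+ (t₁ :+ e₂) :* a)
               refl U S (A (suc m)) (t (suc m)) (e (suc (suc m))))
    (trans (cong (λ z → (U + z * S) + z * A (suc m)) (sym (e≡ (suc m))))
           (cong (_+ e (suc m) * A (suc m)) (abel-summation t e A e≡ m)))
  where
  U = sumTo m (λ k → t k * sumTo k A)
  S = sumTo m A

module ≗-Reasoning = SetoidReasoning (ℕ →-setoid ℚ)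

⊛-congˡ : ∀ {f f′ : Series} g → f ≗ f′ → (f ⊛ g) ≗ (f′ ⊛ g)
⊛-congˡ g f≗ n = sumTo-cong n (λ i _ → cong (_* g (n ∸ i)) (f≗ i))

⊛-congʳ : ∀ f {g g′ : Series} → g ≗ g′ → (f ⊛ g) ≗ (f ⊛ g′)
⊛-congʳ f g≗ n = sumTo-cong n (λ i _ → cong (f i *_) (g≗ (n ∸ i)))

⊛-comm : ∀ f g → (f ⊛ g) ≗ (g ⊛ f)
⊛-comm f g n =
  trans (sumTo-reverse n _)
        (sumTo-cong n (λ i i≤n → trans (cong (λ z → f (n ∸ i) * g z) (ℕₚ.m∸[m∸n]≡n i≤n))
                                       (*-comm (f (n ∸ i)) (g i))))

⊛-assoc : ∀ f g h → ((f ⊛ g) ⊛ h) ≗ (f ⊛ (g ⊛ h))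
⊛-assoc f g h n = sym (begin
    sumTo n (λ i → f i * sumTo (n ∸ i) (λ j → g j * h (n ∸ i ∸ j)))
  ≡⟨ sumTo-cong n (λ i _ → sym (sumTo-*ˡ (n ∸ i) (f i) _)) ⟩
    sumTo n (λ i → sumTo (n ∸ i) (λ j → f i * (g j * h (n ∸ i ∸ j))))
  ≡⟨ sumTo-triangle n (λ i j → f i * (g j * h (n ∸ i ∸ j))) ⟩
    sumTo n (λ m → sumTo m (λ i → f i * (g (m ∸ i) * h (n ∸ i ∸ (m ∸ i)))))
  ≡⟨ sumTo-cong n (λ m _ → sumTo-cong m (λ i i≤m →
       trans (cong (λ z → f i * (g (m ∸ i) * h z)) (remaining-degree i m i≤m))
             (sym (*-assoc (f i) (g (m ∸ i)) (h (n ∸ m)))))) ⟩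
    sumTo n (λ m → sumTo m (λ i → f i * g (m ∸ i) * h (n ∸ m)))
  ≡⟨ sumTo-cong n (λ m _ → sumTo-*ʳ m (h (n ∸ m)) (λ i → f i * g (m ∸ i))) ⟩
    ((f ⊛ g) ⊛ h) n
  ∎)
  where
  open ≡-Reasoning
  remaining-degree : ∀ i m → i ≤ m → n ∸ i ∸ (m ∸ i) ≡ n ∸ m
  remaining-degree i m i≤m = trans (ℕₚ.∸-+-assoc n i (m ∸ i)) (cong (n ∸_) (ℕₚ.m+[n∸m]≡n i≤m))

⊛-exchange : ∀ f g h → (f ⊛ (g ⊛ h)) ≗ (g ⊛ (f ⊛ h))
⊛-exchange f g h = begin
    f ⊛ (g ⊛ h)  ≈⟨ ⊛-assoc f g h ⟨
    (f ⊛ g) ⊛ h  ≈⟨ ⊛-congˡ h (⊛-comm f g) ⟩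
    (g ⊛ f) ⊛ h  ≈⟨ ⊛-assoc g f h ⟩
    g ⊛ (f ⊛ h)  ∎
  where open ≗-Reasoning

⊛-distribʳ : ∀ f g h → ((f ⊕ g) ⊛ h) ≗ ((f ⊛ h) ⊕ (g ⊛ h))
⊛-distribʳ f g h n = trans (sumTo-cong n (λ i _ → *-distribʳ-+ (h (n ∸ i)) (f i) (g i))) (sumTo-+ n _ _)

⊛-identityˡ : ∀ f → (oneS ⊛ f) ≗ f
⊛-identityˡ f zero    = *-identityˡ (f 0)
⊛-identityˡ f (suc n) =
  trans (sumTo-shift n _)
        (trans (cong₂ _+_ (*-identityˡ (f (suc n))) (sumTo-zero n _ (λ i → *-zeroˡ (f (n ∸ i)))))
               (+-identityʳ _))

⊛-identityʳ : ∀ f → (f ⊛ oneS) ≗ f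
⊛-identityʳ f n = trans (⊛-comm f oneS n) (⊛-identityˡ f n)

x⊛-zero : ∀ f → (xS ⊛ f) 0 ≡ 0ℚ
x⊛-zero f = *-zeroˡ (f 0)

x⊛-suc : ∀ f n → (xS ⊛ f) (suc n) ≡ f n
x⊛-suc f n =
  trans (sumTo-shift n _)
        (trans (cong₂ _+_ (*-zeroˡ (f (suc n))) (⊛-identityˡ f n)) (+-identityˡ _))

powS-x : ∀ j k → powS xS j k ≡ δ j k
powS-x zero    k       = refl
powS-x (suc j) zero    = x⊛-zero (powS xS j)
powS-x (suc j) (suc k) = trans (x⊛-suc (powS xS j) k) (powS-x j k)

-- Course-of-values recursion: the memo table holds exactly the earlier values,
-- which is what lets us unfold the definitions of invS and lowerInv.

at-++ˡ : ∀ {A : Set} (d : A) xs ys j → j < length xs → at d (xs ++ ys) j ≡ at d xs j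
at-++ˡ d (x ∷ xs) ys zero    _       = refl
at-++ˡ d (x ∷ xs) ys (suc j) (s≤s p) = at-++ˡ d xs ys j p

at-++-last : ∀ {A : Set} (d : A) xs y → at d (xs ++ y ∷ []) (length xs) ≡ y
at-++-last d []       y = refl
at-++-last d (x ∷ xs) y = at-++-last d xs y

memo-length : ∀ {A : Set} (d : A) s n → length (memo d s n) ≡ n
memo-length d s zero    = refl
memo-length d s (suc n) =
  trans (length-++ (memo d s n)) (trans (ℕₚ.+-comm (length (memo d s n)) 1) (cong suc (memo-length d s n)))

memo-lookup : ∀ {A : Set} (d : A) s n j → j < n → at d (memo d s n) j ≡ cvRec d s j
memo-lookup d s (suc n) j j<1+n with ℕₚ.m<1+n⇒m<n∨m≡n j<1+n
... | inj₁ j<n =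
  trans (at-++ˡ d (memo d s n) _ j (subst (j <_) (sym (memo-length d s n)) j<n)) (memo-lookup d s n j j<n)
... | inj₂ refl =
  subst (λ i → at d (memo d s j ++ (cvRec d s j ∷ [])) i ≡ cvRec d s j)
        (memo-length d s j) (at-++-last d (memo d s j) (cvRec d s j))

invS-suc : ∀ g n → invS g (suc n) ≡ - sumTo n (λ i → g (suc i) * invS g (n ∸ i))
invS-suc g n =
  cong -_ (trans (sumBelow-cong (suc n) (λ i i<1+n →
                   cong (g (suc i) *_) (memo-lookup 0ℚ _ (suc n) (n ∸ i) (s≤s (ℕₚ.m∸n≤m n i)))))
                 (sumBelow-suc n _))

invS-inverse : ∀ g → g 0 ≡ 1ℚ → (g ⊛ invS g) ≗ oneS
invS-inverse g g₀≡1 zero    = trans (cong (_* 1ℚ) g₀≡1) (*-identityʳ 1ℚ)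
invS-inverse g g₀≡1 (suc n) = begin
    (g ⊛ invS g) (suc n)
  ≡⟨ sumTo-shift n _ ⟩
    g 0 * invS g (suc n) + S
  ≡⟨ cong₂ (λ c h → c * h + S) g₀≡1 (invS-suc g n) ⟩
    1ℚ * (- S) + S
  ≡⟨ solve 1 (λ s → con 1ℚ :* (:- s) :+ s := con 0ℚ) refl S ⟩
    0ℚ
  ∎
  where
  open ≡-Reasoning
  S = sumTo n (λ i → g (suc i) * invS g (n ∸ i))

lowerInv-unfold : ∀ R n k → lowerInv R n k ≡ δ n k + - sumBelow n (λ j → R n j * lowerInv R j k)
lowerInv-unfold R n k =
  cong (λ z → δ n k + - z)
       (sumBelow-cong n (λ j j<n → cong (λ row → R n j * row k) (memo-lookup (λ _ → 0ℚ) _ n j j<n)))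

lowerInv-unique : ∀ (R P : Matrix) → (∀ n → R n n ≡ 1ℚ) →
  (∀ n k → sumTo n (λ j → R n j * P j k) ≡ δ n k) → ∀ n k → lowerInv R n k ≡ P n k
lowerInv-unique R P diag RP≡I = <-rec (λ n → ∀ k → lowerInv R n k ≡ P n k) row
  where
  row : ∀ n → (∀ {j} → j < n → ∀ k → lowerInv R j k ≡ P j k) → ∀ k → lowerInv R n k ≡ P n k
  row n earlier k = begin
      lowerInv R n k
    ≡⟨ lowerInv-unfold R n k ⟩
      δ n k + - sumBelow n (λ j → R n j * lowerInv R j k)
    ≡⟨ cong (λ z → δ n k + - z) (sumBelow-cong n (λ j j<n → cong (R n j *_) (earlier j<n k))) ⟩
      δ n k + - S
    ≡⟨ cong (λ z → z + - S) (sym δ≡) ⟩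
      (S + P n k) + - S
    ≡⟨ solve 2 (λ s p → s :+ p :+ (:- s) := p) refl S (P n k) ⟩
      P n k
    ∎
    where
    open ≡-Reasoning
    S = sumBelow n (λ j → R n j * P j k)
    δ≡ : S + P n k ≡ δ n k
    δ≡ = begin
        S + P n k
      ≡⟨ cong (S +_) (sym (trans (cong (_* P n k) (diag n)) (*-identityˡ (P n k)))) ⟩
        S + R n n * P n k
      ≡⟨ sumTo-last n _ ⟨
        sumTo n (λ j → R n j * P j k)
      ≡⟨ RP≡I n k ⟩
        δ n k
      ∎

-- Multiplying its columns
-- by 1 + x² clears the denominators, which yields a three-term recurrence
-- for its entries.
Q : Series
Q = oneS ⊕ powS xS 2

Rmat : Matrix
Rmat = riordan gR fR

Q⊛ : ∀ u → (Q ⊛ u) ≗ (u ⊕ (xS ⊛ (xS ⊛ u)))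
Q⊛ u = begin
    Q ⊛ u                                 ≈⟨ ⊛-distribʳ oneS (powS xS 2) u ⟩
    (oneS ⊛ u) ⊕ ((xS ⊛ (xS ⊛ oneS)) ⊛ u) ≈⟨ (λ n → cong₂ _+_ (⊛-identityˡ u n) (x²⊛ n)) ⟩
    u ⊕ (xS ⊛ (xS ⊛ u))                   ∎
  where
  open ≗-Reasoning
  x²⊛ : ((xS ⊛ (xS ⊛ oneS)) ⊛ u) ≗ (xS ⊛ (xS ⊛ u))
  x²⊛ = begin
    (xS ⊛ (xS ⊛ oneS)) ⊛ u ≈⟨ ⊛-congˡ u (⊛-congʳ xS (⊛-identityʳ xS)) ⟩
    (xS ⊛ xS) ⊛ u          ≈⟨ ⊛-assoc xS xS u ⟩
    xS ⊛ (xS ⊛ u)          ∎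

Q⊛-zero : ∀ u → (Q ⊛ u) 0 ≡ u 0
Q⊛-zero u = trans (Q⊛ u 0) (trans (cong (u 0 +_) (x⊛-zero (xS ⊛ u))) (+-identityʳ (u 0)))

Q⊛-one : ∀ u → (Q ⊛ u) 1 ≡ u 1
Q⊛-one u =
  trans (Q⊛ u 1) (trans (cong (u 1 +_) (trans (x⊛-suc (xS ⊛ u) 0) (x⊛-zero u))) (+-identityʳ (u 1)))

Q⊛-suc-suc : ∀ u n → (Q ⊛ u) (suc (suc n)) ≡ u (suc (suc n)) + u n
Q⊛-suc-suc u n =
  trans (Q⊛ u (suc (suc n))) (cong (u (suc (suc n)) +_) (trans (x⊛-suc (xS ⊛ u) (suc n)) (x⊛-suc u n)))

column : ℕ → Series
column k = gR ⊛ powS fR k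

-- (1 + x²) · column (k+1) = x · column k, since (1 + x²) fR = x.
Q⊛column-suc : ∀ k → (Q ⊛ column (suc k)) ≗ (xS ⊛ column k)
Q⊛column-suc k = begin
    Q ⊛ (gR ⊛ (fR ⊛ powS fR k)) ≈⟨ ⊛-congʳ Q (⊛-exchange gR fR (powS fR k)) ⟩
    Q ⊛ (fR ⊛ column k)         ≈⟨ ⊛-assoc Q fR (column k) ⟨
    (Q ⊛ fR) ⊛ column k         ≈⟨ ⊛-congˡ (column k) Q⊛fR ⟩
    xS ⊛ column k               ∎
  where
  open ≗-Reasoning
  Q⊛fR : (Q ⊛ fR) ≗ xS
  Q⊛fR = begin
    Q ⊛ (xS ⊛ invS Q) ≈⟨ ⊛-exchange Q xS (invS Q) ⟩
    xS ⊛ (Q ⊛ invS Q) ≈⟨ ⊛-congʳ xS (invS-inverse Q refl) ⟩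
    xS ⊛ oneS         ≈⟨ ⊛-identityʳ xS ⟩
    xS                ∎

Q⊛column-zero : (Q ⊛ column 0) ≗ (oneS ⊕ (⊖ xS))
Q⊛column-zero = begin
    Q ⊛ (gR ⊛ oneS)             ≈⟨ ⊛-congʳ Q (⊛-identityʳ gR) ⟩
    Q ⊛ (oneS⊖x ⊛ invS Q)       ≈⟨ ⊛-exchange Q oneS⊖x (invS Q) ⟩
    oneS⊖x ⊛ (Q ⊛ invS Q)       ≈⟨ ⊛-congʳ oneS⊖x (invS-inverse Q refl) ⟩
    oneS⊖x ⊛ oneS               ≈⟨ ⊛-identityʳ oneS⊖x ⟩
    oneS⊖x                      ∎
  where
  open ≗-Reasoning
  oneS⊖x = oneS ⊕ (⊖ xS)

-- Entry recurrences of R, read off coefficientwise from the column identities;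
-- solve-for moves a known term across an equation.

solve-for : ∀ a b c → a + b ≡ c → a ≡ c - b
solve-for a b c a+b≡c =
  trans (solve 2 (λ x y → x := (x :+ y) :+ (:- y)) refl a b) (cong (_- b) a+b≡c)

Rmat-rec : ∀ j k → Rmat (suc (suc j)) (suc k) ≡ Rmat (suc j) k - Rmat j (suc k)
Rmat-rec j k =
  solve-for _ _ _ (trans (sym (Q⊛-suc-suc (column (suc k)) j))
                         (trans (Q⊛column-suc k (suc (suc j))) (x⊛-suc (column k) (suc j))))

Rmat-row1 : ∀ k → Rmat 1 (suc k) ≡ Rmat 0 k
Rmat-row1 k = trans (sym (Q⊛-one (column (suc k)))) (trans (Q⊛column-suc k 1) (x⊛-suc (column k) 0))

Rmat-row0 : ∀ k → Rmat 0 (suc k) ≡ 0ℚ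
Rmat-row0 k = trans (sym (Q⊛-zero (column (suc k)))) (trans (Q⊛column-suc k 0) (x⊛-zero (column k)))

Rmat-column0 : ∀ j → Rmat (suc (suc j)) 0 ≡ - Rmat j 0
Rmat-column0 j =
  trans (solve-for _ _ _ (trans (sym (Q⊛-suc-suc (column 0) j)) (Q⊛column-zero (suc (suc j)))))
        (+-identityˡ _)

Rmat-10 : Rmat 1 0 ≡ - 1ℚ
Rmat-10 = trans (sym (Q⊛-one (column 0))) (Q⊛column-zero 1)

Rmat-above : ∀ n k → n < k → Rmat n k ≡ 0ℚ
Rmat-above zero                (suc k) _       = Rmat-row0 k
Rmat-above (suc zero)          (suc k) (s≤s p) = trans (Rmat-row1 k) (Rmat-above 0 k p)
Rmat-above (suc (suc j))       (suc k) (s≤s p) =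
  trans (Rmat-rec j k)
        (cong₂ _-_ (Rmat-above (suc j) k p)
                   (Rmat-above j (suc k) (ℕₚ.m<n⇒m<1+n (ℕₚ.<-trans (ℕₚ.n<1+n j) p))))

Rmat-diagonal : ∀ n → Rmat n n ≡ 1ℚ
Rmat-diagonal zero          = refl
Rmat-diagonal (suc zero)    = Rmat-row1 0
Rmat-diagonal (suc (suc j)) =
  trans (Rmat-rec j (suc j))
        (cong₂ _-_ (Rmat-diagonal (suc j)) (Rmat-above j (suc (suc j)) (ℕₚ.m<n⇒m<1+n (ℕₚ.n<1+n j))))

-- The inverse L = R⁻¹.  Its entry (n, k) counts the ±1 walks of length n
-- that stay ≥ 0 and end at height ≥ k; we show R · ballotTail = I.

ballotTail : ℕ → ℕ → ℚ
ballotTail zero    k       = δ 0 k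
ballotTail (suc n) zero    = ballotTail n 0 + ballotTail n 1
ballotTail (suc n) (suc k) = ballotTail n k + ballotTail n (suc (suc k))

-- Both cases of the recursion at once (pred 0 = 0).
ballotTail-suc : ∀ n k → ballotTail (suc n) k ≡ ballotTail n (ℕ.pred k) + ballotTail n (suc k)
ballotTail-suc n zero    = refl
ballotTail-suc n (suc k) = refl

ballotTail-above : ∀ n k → n < k → ballotTail n k ≡ 0ℚ
ballotTail-above zero    (suc k) _       = refl
ballotTail-above (suc n) (suc k) (s≤s p) =
  trans (cong₂ _+_ (ballotTail-above n k p)
                   (ballotTail-above n (suc (suc k)) (ℕₚ.m<n⇒m<1+n (ℕₚ.m<n⇒m<1+n p))))
        (+-identityʳ 0ℚ)

-- ballotTail n k = Σ_{j ≥ k} ballot n j, in difference form.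
ballotTail-difference : ∀ n k → ballotTail n k ≡ fromℕ (ballot n k) + ballotTail n (suc k)
ballotTail-difference zero zero    = refl
ballotTail-difference zero (suc k) = refl
ballotTail-difference (suc n) zero =
  trans (cong (ballotTail n 0 +_) (ballotTail-difference n 1))
        (solve 3 (λ a t b → a :+ (t :+ b) := t :+ (a :+ b)) refl
               (ballotTail n 0) (fromℕ (ballot n 1)) (ballotTail n 2))
ballotTail-difference (suc n) (suc k) = begin
    ballotTail n k + ballotTail n (suc (suc k))
  ≡⟨ cong₂ _+_ (ballotTail-difference n k) (ballotTail-difference n (suc (suc k))) ⟩
    (t₁ + e₁) + (t₃ + e₃)
  ≡⟨ solve 4 (λ t₁ e₁ t₃ e₃ → (t₁ :+ e₁) :+ (t₃ :+ e₃) := (t₁ :+ t₃) :+ (e₁ :+ e₃)) refl t₁ e₁ t₃ e₃ ⟩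
    (t₁ + t₃) + (e₁ + e₃)
  ≡⟨ cong (_+ (e₁ + e₃)) (fromℕ-+ (ballot n k) (ballot n (suc (suc k)))) ⟨
    fromℕ (ballot (suc n) (suc k)) + ballotTail (suc n) (suc (suc k))
  ∎
  where
  open ≡-Reasoning
  t₁ = fromℕ (ballot n k)
  t₃ = fromℕ (ballot n (suc (suc k)))
  e₁ = ballotTail n (suc k)
  e₃ = ballotTail n (suc (suc (suc k)))

RL : ℕ → ℕ → ℚ
RL n k = sumTo n (λ j → Rmat n j * ballotTail j k)

RL-row0 : ∀ k → RL 0 k ≡ δ 0 k
RL-row0 k = *-identityˡ (δ 0 k)

RL-row1 : ∀ k → RL 1 k ≡ δ 1 k
RL-row1 k = trans (cong₂ (λ r s → r * ballotTail 0 k + s * ballotTail 1 k) Rmat-10 (Rmat-row1 0)) (row1 k)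
  where
  row1 : ∀ k → (- 1ℚ) * ballotTail 0 k + 1ℚ * ballotTail 1 k ≡ δ 1 k
  row1 zero    = refl
  row1 (suc k) = solve 1 (λ d → con (- 1ℚ) :* con 0ℚ :+ con 1ℚ :* (d :+ con 0ℚ) := d) refl (δ 0 k)

RL-shifted : ∀ n k → sumTo n (λ j → Rmat n j * ballotTail (suc j) k) ≡ RL n (ℕ.pred k) + RL n (suc k)
RL-shifted n k =
  trans (sumTo-cong n (λ j _ →
          trans (cong (Rmat n j *_) (ballotTail-suc j k))
                (*-distribˡ-+ (Rmat n j) (ballotTail j (ℕ.pred k)) (ballotTail j (suc k)))))
        (sumTo-+ n _ _)

-- Row n of R · ballotTail with its first term split off; since R is lower
-- triangular the sum may run up to n + 2.
RL-peel : ∀ n k → RL n k ≡ Rmat n 0 * ballotTail 0 k + sumTo (suc n) (λ j → Rmat n (suc j) * ballotTail (suc j) k)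
RL-peel n k =
  trans (sym (sumTo-vanishing-tail 2 n _ (λ i n<i →
               trans (cong (_* ballotTail i k) (Rmat-above n i n<i)) (*-zeroˡ (ballotTail i k)))))
        (sumTo-shift (suc n) _)

-- The three-term recurrence of R, combined with that of ballotTail:
-- row n+2 of R · ballotTail is determined by rows n and n+1.
RL-step : ∀ n k → RL (suc (suc n)) k ≡ (RL (suc n) (ℕ.pred k) + RL (suc n) (suc k)) - RL n k
RL-step n k = begin
    RL (suc (suc n)) k
  ≡⟨ sumTo-shift (suc n) _ ⟩
    Rmat (suc (suc n)) 0 * E 0 + sumTo (suc n) (λ j → Rmat (suc (suc n)) (suc j) * E (suc j))
  ≡⟨ cong₂ _+_ (cong (_* E 0) (Rmat-column0 n))
               (sumTo-cong (suc n) (λ j _ → trans (cong (_* E (suc j)) (Rmat-rec n j))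
                                                  (*-distribʳ-+ (E (suc j)) (Rmat (suc n) j) (- Rmat n (suc j))))) ⟩
    (- r₀) * E 0 + sumTo (suc n) (λ j → Rmat (suc n) j * E (suc j) + (- Rmat n (suc j)) * E (suc j))
  ≡⟨ cong ((- r₀) * E 0 +_)
          (trans (sumTo-+ (suc n) _ _)
                 (cong (X +_) (trans (sumTo-cong (suc n) (λ j _ → neg-* (Rmat n (suc j)) (E (suc j))))
                                     (sumTo-neg (suc n) _)))) ⟩
    (- r₀) * E 0 + (X + - Y)
  ≡⟨ solve 4 (λ a e x y → (:- a) :* e :+ (x :+ (:- y)) := x :+ (:- (a :* e :+ y))) refl r₀ (E 0) X Y ⟩
    X - (r₀ * E 0 + Y)
  ≡⟨ cong₂ _-_ (RL-shifted (suc n) k) (sym (RL-peel n k)) ⟩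
    (RL (suc n) (ℕ.pred k) + RL (suc n) (suc k)) - RL n k
  ∎
  where
  open ≡-Reasoning
  E : ℕ → ℚ
  E j = ballotTail j k
  r₀ = Rmat n 0
  X = sumTo (suc n) (λ j → Rmat (suc n) j * E (suc j))
  Y = sumTo (suc n) (λ j → Rmat n (suc j) * E (suc j))
  neg-* : ∀ x y → (- x) * y ≡ - (x * y)
  neg-* = solve 2 (λ x y → (:- x) :* y := :- (x :* y)) refl

-- The identity matrix obeys the same recurrence.
δ-step : ∀ n k → (δ (suc n) (ℕ.pred k) + δ (suc n) (suc k)) - δ n k ≡ δ (suc (suc n)) k
δ-step n zero    = solve 1 (λ d → con 0ℚ :+ d :+ (:- d) := con 0ℚ) refl (δ n 0)
δ-step n (suc k) = solve 2 (λ a d → a :+ d :+ (:- d) := a) refl (δ (suc n) k) (δ n (suc k))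

RL≡I : ∀ n k → RL n k ≡ δ n k
RL≡I n = proj₁ (rows n)
  where
  rows : ∀ n → (∀ k → RL n k ≡ δ n k) × (∀ k → RL (suc n) k ≡ δ (suc n) k)
  rows zero    = RL-row0 , RL-row1
  rows (suc n) = row-suc-n , row-n+2
    where
    row-n     = proj₁ (rows n)
    row-suc-n = proj₂ (rows n)
    row-n+2 : ∀ k → RL (suc (suc n)) k ≡ δ (suc (suc n)) k
    row-n+2 k =
      trans (RL-step n k)
            (trans (cong₂ _-_ (cong₂ _+_ (row-suc-n (ℕ.pred k)) (row-suc-n (suc k))) (row-n k))
                   (δ-step n k))

Lmat≡ballotTail : ∀ n k → Lmat n k ≡ ballotTail n k
Lmat≡ballotTail = lowerInv-unique Rmat ballotTail Rmat-diagonal RL≡I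

δ-≢ : ∀ m n → m ≢ n → δ m n ≡ 0ℚ
δ-≢ zero    zero    m≢n = contradiction refl m≢n
δ-≢ zero    (suc n) _   = refl
δ-≢ (suc m) zero    _   = refl
δ-≢ (suc m) (suc n) m≢n = δ-≢ m n (m≢n ∘ cong suc)

δ-refl : ∀ n → δ n n ≡ 1ℚ
δ-refl zero    = refl
δ-refl (suc n) = δ-refl n

sum-δ-beyond : ∀ n k (F : ℕ → ℚ) → n < k → sumTo n (λ j → F j * δ j k) ≡ 0ℚ
sum-δ-beyond zero    k F n<k = trans (cong (F 0 *_) (δ-≢ 0 k (ℕₚ.<⇒≢ n<k))) (*-zeroʳ (F 0))
sum-δ-beyond (suc n) k F n<k =
  cong₂ _+_ (sum-δ-beyond n k F (ℕₚ.<-trans (ℕₚ.n<1+n n) n<k))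
            (trans (cong (F (suc n) *_) (δ-≢ (suc n) k (ℕₚ.<⇒≢ n<k))) (*-zeroʳ (F (suc n))))

sum-δ-within : ∀ n k (F : ℕ → ℚ) → k ≤ n → sumTo n (λ j → F j * δ j k) ≡ F k
sum-δ-within zero    zero F z≤n = *-identityʳ (F 0)
sum-δ-within (suc n) k F k≤1+n with ℕₚ.m≤n⇒m<n∨m≡n k≤1+n
... | inj₁ k<1+n =
  trans (cong₂ _+_ (sum-δ-within n k F (ℕₚ.≤-pred k<1+n))
                   (trans (cong (F (suc n) *_) (δ-≢ (suc n) k (ℕₚ.<⇒≢ k<1+n ∘ sym))) (*-zeroʳ (F (suc n)))))
        (+-identityʳ (F k))
... | inj₂ refl =
  trans (cong₂ _+_ (sum-δ-beyond n (suc n) F (ℕₚ.n<1+n n))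
                   (trans (cong (F (suc n) *_) (δ-refl (suc n))) (*-identityʳ (F (suc n)))))
        (+-identityˡ (F (suc n)))

sum-ballotTail-δ : ∀ n k → sumTo n (λ j → ballotTail n j * δ j k) ≡ ballotTail n k
sum-ballotTail-δ n k with k ℕ.≤? n
... | yes k≤n = sum-δ-within n k (ballotTail n) k≤n
... | no  k≰n = trans (sum-δ-beyond n k (ballotTail n) (ℕₚ.≰⇒> k≰n))
                      (sym (ballotTail-above n k (ℕₚ.≰⇒> k≰n)))

Umat-entries : ∀ j k → Umat j k ≡ δ j k + δ (suc j) k
Umat-entries j k =
  trans (⊛-distribʳ oneS xS (powS xS j) k)
        (cong₂ _+_ (trans (⊛-identityˡ (powS xS j) k) (powS-x j k)) (powS-x (suc j) k))

Bmat-split : ∀ n k → Bmat n k ≡ sumTo n (λ j → ballotTail n j * δ j k) + sumTo n (λ j → ballotTail n j * δ (suc j) k)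
Bmat-split n k =
  trans (sumTo-cong n (λ j _ → trans (cong₂ _*_ (Lmat≡ballotTail n j) (Umat-entries j k))
                                     (*-distribˡ-+ (ballotTail n j) (δ j k) (δ (suc j) k))))
        (sumTo-+ n _ _)

Bmat-column0 : ∀ n → Bmat n 0 ≡ ballotTail n 0
Bmat-column0 n =
  trans (Bmat-split n 0)
        (trans (cong₂ _+_ (sum-ballotTail-δ n 0) (sumTo-zero n _ (λ j → *-zeroʳ (ballotTail n j))))
               (+-identityʳ (ballotTail n 0)))

Bmat-column-suc : ∀ n k → Bmat n (suc k) ≡ ballotTail n (suc k) + ballotTail n k
Bmat-column-suc n k = trans (Bmat-split n (suc k)) (cong₂ _+_ (sum-ballotTail-δ n (suc k)) (sum-ballotTail-δ n k))

bSeq-ballotTail : ∀ a n → bSeq a n ≡ sumTo n (λ k → ballotTail n k * (a k + a (suc k)))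
bSeq-ballotTail a n = begin
    sumTo (suc n) (λ k → Bmat n k * a k)
  ≡⟨ sumTo-shift n _ ⟩
    Bmat n 0 * a 0 + sumTo n (λ k → Bmat n (suc k) * a (suc k))
  ≡⟨ cong₂ _+_ (cong (_* a 0) (Bmat-column0 n))
               (sumTo-cong n (λ k _ → trans (cong (_* a (suc k)) (Bmat-column-suc n k))
                                            (*-distribʳ-+ (a (suc k)) (E (suc k)) (E k)))) ⟩
    E 0 * a 0 + sumTo n (λ k → E (suc k) * a (suc k) + E k * a (suc k))
  ≡⟨ cong (E 0 * a 0 +_) (sumTo-+ n _ _) ⟩
    E 0 * a 0 + (S₁ + S₂)
  ≡⟨ +-assoc (E 0 * a 0) S₁ S₂ ⟨
    (E 0 * a 0 + S₁) + S₂
  ≡⟨ cong (_+ S₂) (sumTo-shift n (λ k → E k * a k)) ⟨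
    sumTo (suc n) (λ k → E k * a k) + S₂
  ≡⟨ cong (_+ S₂) (sumTo-vanishing-tail 1 n _ (λ i n<i → trans (cong (_* a i) (ballotTail-above n i n<i)) (*-zeroˡ (a i)))) ⟩
    sumTo n (λ k → E k * a k) + S₂
  ≡⟨ trans (sumTo-cong n (λ k _ → *-distribˡ-+ (E k) (a k) (a (suc k)))) (sumTo-+ n _ _) ⟨
    sumTo n (λ k → E k * (a k + a (suc k)))
  ∎
  where
  open ≡-Reasoning
  E : ℕ → ℚ
  E = ballotTail n
  S₁ = sumTo n (λ k → E (suc k) * a (suc k))
  S₂ = sumTo n (λ k → E k * a (suc k))

inner-sum-pairs : ∀ (a : ℕ → ℚ) k → sumTo k a + sumFromTo 1 (suc k) a ≡ sumTo k (λ j → a j + a (suc j))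
inner-sum-pairs a k =
  trans (cong (sumTo k a +_) (sumBelow-suc k (λ i → a (suc i)))) (sym (sumTo-+ k a (λ i → a (suc i))))

inner-sum-doubled : ∀ (a : ℕ → ℚ) k →
  sumTo k a + sumFromTo 1 (suc k) a ≡ (sumTo k a + sumTo k a) + a (suc k) - a 0
inner-sum-doubled a k = begin
    s + sumBelow (suc k) (λ i → a (suc i))
  ≡⟨ cong (s +_) (sumBelow-suc k (λ i → a (suc i))) ⟩
    s + t
  ≡⟨ solve 3 (λ s t a₀ → s :+ t := s :+ ((a₀ :+ t) :+ (:- a₀))) refl s t (a 0) ⟩
    s + ((a 0 + t) - a 0)
  ≡⟨ cong (λ z → s + (z - a 0)) (sumTo-shift k a) ⟨
    s + ((s + a (suc k)) - a 0)
  ≡⟨ solve 3 (λ s b a₀ → s :+ ((s :+ b) :+ (:- a₀)) := (s :+ s) :+ b :+ (:- a₀)) refl s (a (suc k)) (a 0) ⟩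
    (s + s) + a (suc k) - a 0
  ∎
  where
  open ≡-Reasoning
  s = sumTo k a
  t = sumTo k (λ i → a (suc i))

mainTheorem2 : (a : ℕ → ℚ) → (n : ℕ) →
    (bSeq a n ≡ sumTo n (λ k → coef n k * (sumTo k a + sumFromTo 1 (suc k) a)))
    × (bSeq a n ≡ sumTo n (λ k → coef n k * ((sumTo k a + sumTo k a) + a (suc k) - a 0)))
mainTheorem2 a n = first-form , trans first-form (sumTo-cong n (λ k _ → cong (coef n k *_) (inner-sum-doubled a k)))
  where
  open ≡-Reasoning
  A : ℕ → ℚ
  A j = a j + a (suc j)
  first-form : bSeq a n ≡ sumTo n (λ k → coef n k * (sumTo k a + sumFromTo 1 (suc k) a))
  first-form = begin
      bSeq a n
    ≡⟨ bSeq-ballotTail a n ⟩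
      sumTo n (λ k → ballotTail n k * A k)
    ≡⟨ abel-summation (λ k → fromℕ (ballot n k)) (ballotTail n) A (ballotTail-difference n) n ⟨
      sumTo n (λ k → fromℕ (ballot n k) * sumTo k A) + ballotTail n (suc n) * sumTo n A
    ≡⟨ cong (λ e → sumTo n (λ k → fromℕ (ballot n k) * sumTo k A) + e * sumTo n A)
            (ballotTail-above n (suc n) (ℕₚ.n<1+n n)) ⟩
      sumTo n (λ k → fromℕ (ballot n k) * sumTo k A) + 0ℚ * sumTo n A
    ≡⟨ cong (sumTo n (λ k → fromℕ (ballot n k) * sumTo k A) +_) (*-zeroˡ (sumTo n A)) ⟩
      sumTo n (λ k → fromℕ (ballot n k) * sumTo k A) + 0ℚ
    ≡⟨ +-identityʳ _ ⟩
      sumTo n (λ k → fromℕ (ballot n k) * sumTo k A)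
    ≡⟨ sumTo-cong n (λ k k≤n → cong₂ _*_ (coef-ballot n k k≤n) (inner-sum-pairs a k)) ⟨
      sumTo n (λ k → coef n k * (sumTo k a + sumFromTo 1 (suc k) a))
    ∎
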